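{- Let $f:2^V\to\mathbb{R}$ be a submodular function with $f(\emptyset)=0$ and $u_f\ge0$. Let $\{\pi^{(t)}\}_{t\in[m]}$ be permutations of $V$ and $y:=\frac1m\sum_{t\in[m]}g_{\pi^{(t)}}$. Define the random vector $$w:=\frac{(2\|u_f\|_1-f(V))\cdot(g_{\pi^{(i)}})_p}{2(u_f)_p-(g_{\pi^{(i)}})_p}\cdot\mathbf{1}_p,$$ where $i\in[m]$ is uniformly random and, given $i$, $p\in V$ is sampled with probability proportional to $2(u_f)_p-(g_{\pi^{(i)}})_p$. Then (1) $\mathbb{E}[w]=y$; (2) $\|w\|_\infty\le 2\|u_f\|_1-f(V)$ with probability $1$; and (3) $\mathbb{E}[w_q^2]\le(2\|u_f\|_1-f(V))(2(u_f)_q-y_q)$ for every $q\in V$.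
   Context: $(u_f)_p=f(\{p\})$. For a bijection $\pi:[n]\to V$, $\pi[i]=\{\pi(1),\dots,\pi(i)\}$, $\pi[0]=\emptyset$, and $(g_\pi)_{\pi(i)}=f(\pi[i])-f(\pi[i-1])$. $\mathbf{1}_p$ is the standard basis vector for $p$.
   Formalization: The submodular function f takes values in ℚ rather than ℝ, so $u_f$, y and w have rational entries. -}

module Defs where

import Data.Integer as ℤ
open import Data.Nat as ℕ using (ℕ; zero; suc; _<ᵇ_)
open import Data.Fin as Fin using (Fin; toℕ)
open import Data.Fin.Subset using (Subset; ⁅_⁆; ⊥; ⊤; _∪_; _∩_)
open import Data.Fin.Permutation using (Permutation′; _⟨$⟩ʳ_; _⟨$⟩ˡ_)
open import Data.Vec using (tabulate)
open import Data.Rational using (ℚ; 0ℚ; 1ℚ; _+_; _-_; _*_; _÷_; _≤_; _⊔_; ∣_∣; ≢-nonZero)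
import Data.Rational.Properties as ℚP
open import Relation.Nullary using (yes; no)

Σ : (n : ℕ) → (Fin n → ℚ) → ℚ
Σ zero    a = 0ℚ
Σ (suc n) a = a Fin.zero + Σ n (λ i → a (Fin.suc i))

‖_‖∞ : {n : ℕ} → (Fin n → ℚ) → ℚ
‖_‖∞ {zero}  v = 0ℚ
‖_‖∞ {suc n} v = ∣ v Fin.zero ∣ ⊔ ‖ (λ i → v (Fin.suc i)) ‖∞

‖_‖₁ : {n : ℕ} → (Fin n → ℚ) → ℚ
‖_‖₁ {n} v = Σ n (λ p → ∣ v p ∣)

-- "total" division: a / b, and 0 when b = 0 (only used where the value is
-- irrelevant, i.e. multiplied by a zero probability)
_/'_ : ℚ → ℚ → ℚ
a /' b with b ℚP.≟ 0ℚ
... | yes _ = 0ℚ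
... | no b≢0 = _÷_ a b {{≢-nonZero b≢0}}

2ℚ : ℚ
2ℚ = 1ℚ + 1ℚ

Submodular : {n : ℕ} → (Subset n → ℚ) → Set
Submodular f = ∀ A B → f (A ∪ B) + f (A ∩ B) ≤ f A + f B

u : {n : ℕ} → (Subset n → ℚ) → Fin n → ℚ
u f p = f ⁅ p ⁆

-- π[k] = {π(1),…,π(k)}  (1-indexed) = { q | π⁻¹(q) < k }  (0-indexed Fin)
prefix : {n : ℕ} → Permutation′ n → ℕ → Subset n
prefix π k = tabulate (λ q → toℕ (π ⟨$⟩ˡ q) <ᵇ k)

-- (g_π)_{π(i)} = f(π[i]) − f(π[i−1])
g : {n : ℕ} → (Subset n → ℚ) → Permutation′ n → Fin n → ℚ
g f π q = f (prefix π (suc (toℕ (π ⟨$⟩ˡ q)))) - f (prefix π (toℕ (π ⟨$⟩ˡ q)))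

𝟏 : {n : ℕ} → Fin n → Fin n → ℚ
𝟏 p q with p Fin.≟ q
... | yes _ = 1ℚ
... | no _  = 0ℚ

module Sampling {n : ℕ} (m : ℕ) (f : Subset n → ℚ) (πs : Fin m → Permutation′ n) where

  Z : ℚ
  Z = 2ℚ * ‖ u f ‖₁ - f ⊤

  y : Fin n → ℚ
  y q = Σ m (λ t → g f (πs t) q) /' Data.Rational._/_ (ℤ.+ m) 1

  weight : Fin m → Fin n → ℚ
  weight i p = 2ℚ * u f p - g f (πs i) p

  prob : Fin m → Fin n → ℚ
  prob i p = (weight i p /' Σ n (weight i)) /' Data.Rational._/_ (ℤ.+ m) 1

  w : Fin m → Fin n → Fin n → ℚ
  w i p q = ((Z * g f (πs i) p) /' weight i p) * 𝟏 p q

  𝔼 : (Fin m → Fin n → ℚ) → ℚ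
  𝔼 X = Σ m (λ i → Σ n (λ p → prob i p * X i p))

{-# OPTIONS --safe #-}

-- Submodularity and f(∅) = 0 bound every marginal gain by the singleton value,
-- (g_π)_q ≤ (u_f)_q, so with u_f ≥ 0 the weights 2(u_f)_q − (g_π)_q are non-negative
-- and dominate |(g_π)_q|; and since the gains along π telescope to f(V), the weights of
-- each permutation sum to Z = 2‖u_f‖₁ − f(V). Hence w is an importance-sampling
-- estimator: the weight cancels in the mean, |w_p| = Z |(g_π)_p| / weight_p ≤ Z, and
-- E[w_q²] = (1/m) Σ_i Z (g_π)_q² / weight_q ≤ (1/m) Σ_i Z weight_q = Z (2(u_f)_q − y_q).

module Submission where

open import Defs
open import Data.Nat as ℕ using (ℕ; zero; suc; NonZero)
import Data.Nat.Properties as ℕP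
open import Data.Nat.Coprimality using (1-coprimeTo) renaming (sym to coprime-sym)
import Data.Integer as ℤ
import Data.Integer.Properties as ℤP
open import Data.Fin as Fin using (Fin; toℕ)
import Data.Fin.Properties as FinP
open import Data.Fin.Subset using (Subset; ⁅_⁆; ⊥; ⊤; _∪_; _∩_; _∈_)
open import Data.Fin.Subset.Properties
  using (Empty-unique; ⊆-antisym; ⊆⊤; x∈⁅x⁆; x∈⁅y⁆⇒x≡y; x∈p∪q⁺; x∈p∪q⁻; x∈p∩q⁻)
open import Data.Fin.Permutation using (Permutation′; _⟨$⟩ʳ_; _⟨$⟩ˡ_; inverseˡ; inverseʳ)
open import Data.Vec.Properties using (lookup∘tabulate; lookup⇒[]=; []=⇒lookup)
open import Data.Bool.Properties using (T-≡)
open import Data.Rational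
  using (ℚ; mkℚ; 0ℚ; 1ℚ; _+_; _-_; -_; _*_; _/_; ∣_∣; _≤_; _<_; 1/_; ≢-nonZero; nonNegative; positive)
import Data.Rational.Properties as ℚP
open import Data.Rational.Solver using (module +-*-Solver)
open import Algebra.Properties.CommutativeMonoid.Sum ℚP.+-0-commutativeMonoid using (sum; sum-permute)
open import Data.Product using (_×_; _,_)
open import Data.Sum using (inj₁; inj₂)
open import Function using (_∘_; Equivalence)
open import Relation.Nullary using (yes; no; contradiction)
open import Relation.Nullary.Decidable using (toSum)
open import Relation.Binary.Definitions using (tri<; tri≈; tri>)
open import Relation.Binary.PropositionalEquality

open +-*-Solver

≤∧≢⇒< : ∀ {p q} → p ≤ q → p ≢ q → p < q
≤∧≢⇒< {p} {q} p≤q p≢q with ℚP.<-cmp p q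
... | tri< p<q _ _ = p<q
... | tri≈ _ p≡q _ = contradiction p≡q p≢q
... | tri> _ _ q<p = contradiction (ℚP.<-≤-trans q<p p≤q) (ℚP.<-irrefl refl)

p≤q⇒0≤q-p : ∀ {p q} → p ≤ q → 0ℚ ≤ q - p
p≤q⇒0≤q-p {p} {q} p≤q = subst (_≤ q - p) (ℚP.+-inverseʳ p) (ℚP.+-monoˡ-≤ (- p) p≤q)

0≤q-p⇒p≤q : ∀ {p q} → 0ℚ ≤ q - p → p ≤ q
0≤q-p⇒p≤q {p} {q} 0≤q-p = subst₂ _≤_ (ℚP.+-identityˡ p)
  (solve 2 (λ p q → (q :- p) :+ p := q) refl p q) (ℚP.+-monoˡ-≤ p 0≤q-p)

p≤∣p∣ : ∀ p → p ≤ ∣ p ∣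
p≤∣p∣ (mkℚ (ℤ.+ _) _ _)      = ℚP.≤-refl
p≤∣p∣ p@(mkℚ ℤ.-[1+ _ ] _ _) = ℚP.<⇒≤ (ℚP.neg<pos p ∣ p ∣)

∣p∣≤2q-p : ∀ {p q} → p ≤ q → 0ℚ ≤ q → ∣ p ∣ ≤ 2ℚ * q - p
∣p∣≤2q-p {p} {q} p≤q 0≤q with ℚP.∣p∣≡p∨∣p∣≡-p p
... | inj₁ ∣p∣≡p  = subst (_≤ 2ℚ * q - p) (sym ∣p∣≡p) (0≤q-p⇒p≤q (subst (0ℚ ≤_)
  (solve 2 (λ p q → (q :- p) :+ (q :- p) := (con 2ℚ :* q :- p) :- p) refl p q)
  (ℚP.+-mono-≤ (p≤q⇒0≤q-p p≤q) (p≤q⇒0≤q-p p≤q))))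
... | inj₂ ∣p∣≡-p = subst (_≤ 2ℚ * q - p) (sym ∣p∣≡-p) (0≤q-p⇒p≤q (subst (0ℚ ≤_)
  (solve 2 (λ p q → q :+ q := (con 2ℚ :* q :- p) :- (:- p)) refl p q)
  (ℚP.+-mono-≤ 0≤q 0≤q)))

-- 1ℚ /' b serves as the inverse of b, junk value 0 included, so every /' becomes a product.
/'≡*1/' : ∀ a b → a /' b ≡ a * (1ℚ /' b)
/'≡*1/' a b with b ℚP.≟ 0ℚ
... | yes _ = sym (ℚP.*-zeroʳ a)
... | no  _ = cong (a *_) (sym (ℚP.*-identityˡ _))

1/'-nonNeg : ∀ {b} → 0ℚ ≤ b → 0ℚ ≤ 1ℚ /' b
1/'-nonNeg {b} 0≤b with b ℚP.≟ 0ℚ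
... | yes _   = ℚP.≤-refl
... | no  b≢0 = subst (0ℚ ≤_) (sym (ℚP.*-identityˡ 1/b)) (ℚP.<⇒≤ (ℚP.positive⁻¹ 1/b {{1/b>0}}))
  where
  1/b = (1/ b) {{≢-nonZero b≢0}}
  1/b>0 = ℚP.1/pos⇒pos b {{positive (≤∧≢⇒< 0≤b (b≢0 ∘ sym))}}

*-1/'-inverse : ∀ {b} → b ≢ 0ℚ → b * (1ℚ /' b) ≡ 1ℚ
*-1/'-inverse {b} b≢0 with b ℚP.≟ 0ℚ
... | yes b≡0 = contradiction b≡0 b≢0
... | no  b≢0 = trans (cong (b *_) (ℚP.*-identityˡ _)) (ℚP.*-inverseʳ b {{≢-nonZero b≢0}})

/'-*-comm : ∀ a b c → (a /' c) * b ≡ (a * b) /' c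
/'-*-comm a b c = begin
  (a /' c) * b          ≡⟨ cong (_* b) (/'≡*1/' a c) ⟩
  a * (1ℚ /' c) * b     ≡⟨ solve 3 (λ a b r → a :* r :* b := a :* b :* r) refl a b (1ℚ /' c) ⟩
  a * b * (1ℚ /' c)     ≡⟨ /'≡*1/' (a * b) c ⟨
  (a * b) /' c          ∎
  where open ≡-Reasoning

*-/'-assoc : ∀ a b c → (a * b) /' c ≡ a * (b /' c)
*-/'-assoc a b c = begin
  (a * b) /' c          ≡⟨ /'≡*1/' (a * b) c ⟩
  a * b * (1ℚ /' c)     ≡⟨ ℚP.*-assoc a b (1ℚ /' c) ⟩
  a * (b * (1ℚ /' c))   ≡⟨ cong (a *_) (/'≡*1/' b c) ⟨
  a * (b /' c)          ∎
  where open ≡-Reasoning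

/'-monoˡ-≤ : ∀ {a b c} → 0ℚ ≤ c → a ≤ b → a /' c ≤ b /' c
/'-monoˡ-≤ {a} {b} {c} 0≤c a≤b = subst₂ _≤_ (sym (/'≡*1/' a c)) (sym (/'≡*1/' b c))
  (ℚP.*-monoʳ-≤-nonNeg (1ℚ /' c) {{nonNegative (1/'-nonNeg 0≤c)}} a≤b)

n/1≡mkℚ : ∀ k → ℤ.+ k / 1 ≡ mkℚ (ℤ.+ k) 0 (coprime-sym (1-coprimeTo k))
n/1≡mkℚ k = ℚP.↥p/↧p≡p (mkℚ (ℤ.+ k) 0 (coprime-sym (1-coprimeTo k)))

[1+n]/1≡1+n/1 : ∀ k → ℤ.+ suc k / 1 ≡ 1ℚ + ℤ.+ k / 1
[1+n]/1≡1+n/1 k = begin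
  ℤ.+ suc k / 1                                         ≡⟨ cong (λ j → (ℤ.+ 1 ℤ.+ j) / 1) (sym (ℤP.*-identityʳ (ℤ.+ k))) ⟩
  (ℤ.+ 1 ℤ.+ ℤ.+ k ℤ.* ℤ.+ 1) / 1                       ≡⟨⟩   -- ℚ addition unfolds on denominators 1
  1ℚ + mkℚ (ℤ.+ k) 0 (coprime-sym (1-coprimeTo k))      ≡⟨ cong (λ x → 1ℚ + x) (n/1≡mkℚ k) ⟨
  1ℚ + ℤ.+ k / 1                                        ∎
  where open ≡-Reasoning

-- Finite sums

Σ-cong : ∀ n {a b : Fin n → ℚ} → (∀ i → a i ≡ b i) → Σ n a ≡ Σ n b
Σ-cong zero    a≡b = refl
Σ-cong (suc n) a≡b = cong₂ _+_ (a≡b Fin.zero) (Σ-cong n (a≡b ∘ Fin.suc))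

Σ-distrib-minus : ∀ n (a b : Fin n → ℚ) → Σ n (λ i → a i - b i) ≡ Σ n a - Σ n b
Σ-distrib-minus zero    a b = refl
Σ-distrib-minus (suc n) a b =
  trans (cong (λ s → a Fin.zero - b Fin.zero + s) (Σ-distrib-minus n (a ∘ Fin.suc) (b ∘ Fin.suc)))
        (solve 4 (λ x y s t → (x :- y) :+ (s :- t) := (x :+ s) :- (y :+ t)) refl
               (a Fin.zero) (b Fin.zero) (Σ n (a ∘ Fin.suc)) (Σ n (b ∘ Fin.suc)))

*-distribʳ-Σ : ∀ n c (a : Fin n → ℚ) → Σ n a * c ≡ Σ n (λ i → a i * c)
*-distribʳ-Σ zero    c a = ℚP.*-zeroˡ c
*-distribʳ-Σ (suc n) c a =
  trans (ℚP.*-distribʳ-+ c (a Fin.zero) _) (cong (a Fin.zero * c +_) (*-distribʳ-Σ n c (a ∘ Fin.suc)))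

*-distribˡ-Σ : ∀ n c (a : Fin n → ℚ) → c * Σ n a ≡ Σ n (λ i → c * a i)
*-distribˡ-Σ n c a = trans (ℚP.*-comm c (Σ n a))
  (trans (*-distribʳ-Σ n c a) (Σ-cong n (λ i → ℚP.*-comm (a i) c)))

Σ-/' : ∀ n (a : Fin n → ℚ) c → Σ n (λ i → a i /' c) ≡ Σ n a /' c
Σ-/' n a c = begin
  Σ n (λ i → a i /' c)           ≡⟨ Σ-cong n (λ i → /'≡*1/' (a i) c) ⟩
  Σ n (λ i → a i * (1ℚ /' c))    ≡⟨ *-distribʳ-Σ n (1ℚ /' c) a ⟨
  Σ n a * (1ℚ /' c)              ≡⟨ /'≡*1/' (Σ n a) c ⟨
  Σ n a /' c                     ∎
  where open ≡-Reasoning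

Σ-const : ∀ k c → Σ k (λ _ → c) ≡ (ℤ.+ k / 1) * c
Σ-const zero    c = sym (ℚP.*-zeroˡ c)
Σ-const (suc k) c = begin
  c + Σ k (λ _ → c)          ≡⟨ cong (c +_) (Σ-const k c) ⟩
  c + (ℤ.+ k / 1) * c        ≡⟨ solve 2 (λ c x → c :+ x :* c := (con 1ℚ :+ x) :* c) refl c (ℤ.+ k / 1) ⟩
  (1ℚ + ℤ.+ k / 1) * c       ≡⟨ cong (_* c) ([1+n]/1≡1+n/1 k) ⟨
  (ℤ.+ suc k / 1) * c        ∎
  where open ≡-Reasoning

Σ-mono-≤ : ∀ n {a b : Fin n → ℚ} → (∀ i → a i ≤ b i) → Σ n a ≤ Σ n b
Σ-mono-≤ zero    a≤b = ℚP.≤-refl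
Σ-mono-≤ (suc n) a≤b = ℚP.+-mono-≤ (a≤b Fin.zero) (Σ-mono-≤ n (a≤b ∘ Fin.suc))

Σ-nonNeg : ∀ n {a : Fin n → ℚ} → (∀ i → 0ℚ ≤ a i) → 0ℚ ≤ Σ n a
Σ-nonNeg zero    0≤a = ℚP.≤-refl
Σ-nonNeg (suc n) 0≤a = ℚP.+-mono-≤ (0≤a Fin.zero) (Σ-nonNeg n (0≤a ∘ Fin.suc))

term≤Σ : ∀ n {a : Fin n → ℚ} → (∀ i → 0ℚ ≤ a i) → ∀ j → a j ≤ Σ n a
term≤Σ (suc n) {a} 0≤a Fin.zero =
  subst (_≤ Σ (suc n) a) (ℚP.+-identityʳ (a Fin.zero))
        (ℚP.+-monoʳ-≤ (a Fin.zero) (Σ-nonNeg n (0≤a ∘ Fin.suc)))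
term≤Σ (suc n) {a} 0≤a (Fin.suc j) =
  subst (_≤ Σ (suc n) a) (ℚP.+-identityˡ (a (Fin.suc j)))
        (ℚP.+-mono-≤ (0≤a Fin.zero) (term≤Σ n (0≤a ∘ Fin.suc) j))

Σ-vanishing-off : ∀ n (a : Fin n → ℚ) q → (∀ p → p ≢ q → a p ≡ 0ℚ) → Σ n a ≡ a q
Σ-vanishing-off (suc n) a Fin.zero a≡0 = begin
  a Fin.zero + Σ n (a ∘ Fin.suc)   ≡⟨ cong (a Fin.zero +_) (Σ-cong n (λ p → a≡0 (Fin.suc p) λ ())) ⟩
  a Fin.zero + Σ n (λ _ → 0ℚ)      ≡⟨ cong (a Fin.zero +_) (trans (Σ-const n 0ℚ) (ℚP.*-zeroʳ (ℤ.+ n / 1))) ⟩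
  a Fin.zero + 0ℚ                  ≡⟨ ℚP.+-identityʳ (a Fin.zero) ⟩
  a Fin.zero                       ∎
  where open ≡-Reasoning
Σ-vanishing-off (suc n) a (Fin.suc q) a≡0 = begin
  a Fin.zero + Σ n (a ∘ Fin.suc)   ≡⟨ cong₂ _+_ (a≡0 Fin.zero λ ()) (Σ-vanishing-off n (a ∘ Fin.suc) q a∘suc≡0) ⟩
  0ℚ + a (Fin.suc q)               ≡⟨ ℚP.+-identityˡ (a (Fin.suc q)) ⟩
  a (Fin.suc q)                    ∎
  where
  open ≡-Reasoning
  a∘suc≡0 : ∀ p → p ≢ q → a (Fin.suc p) ≡ 0ℚ
  a∘suc≡0 p p≢q = a≡0 (Fin.suc p) (p≢q ∘ FinP.suc-injective)

Σ≡sum : ∀ n (a : Fin n → ℚ) → Σ n a ≡ sum a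
Σ≡sum zero    a = refl
Σ≡sum (suc n) a = cong (a Fin.zero +_) (Σ≡sum n (a ∘ Fin.suc))

Σ-permute : ∀ n (a : Fin n → ℚ) (π : Permutation′ n) → Σ n a ≡ Σ n (a ∘ (π ⟨$⟩ʳ_))
Σ-permute n a π = trans (Σ≡sum n a) (trans (sum-permute a π) (sym (Σ≡sum n _)))

Σ-telescope : ∀ n (F : ℕ → ℚ) → Σ n (λ k → F (suc (toℕ k)) - F (toℕ k)) ≡ F n - F 0
Σ-telescope zero    F = sym (ℚP.+-inverseʳ (F 0))
Σ-telescope (suc n) F =
  trans (cong (F 1 - F 0 +_) (Σ-telescope n (F ∘ suc)))
        (solve 3 (λ a b c → (a :- b) :+ (c :- a) := c :- b) refl (F 1) (F 0) (F (suc n)))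

𝟏-refl : ∀ {n} (q : Fin n) → 𝟏 q q ≡ 1ℚ
𝟏-refl q with q Fin.≟ q
... | yes _   = refl
... | no  q≢q = contradiction refl q≢q

𝟏-≢ : ∀ {n} {p q : Fin n} → p ≢ q → 𝟏 p q ≡ 0ℚ
𝟏-≢ {p = p} {q} p≢q with p Fin.≟ q
... | yes p≡q = contradiction p≡q p≢q
... | no  _   = refl

𝟏-idem : ∀ {n} (p q : Fin n) → 𝟏 p q * 𝟏 p q ≡ 𝟏 p q
𝟏-idem p q with p Fin.≟ q
... | yes _ = refl
... | no  _ = refl

∣a*𝟏∣≤∣a∣ : ∀ {n} a (p q : Fin n) → ∣ a * 𝟏 p q ∣ ≤ ∣ a ∣
∣a*𝟏∣≤∣a∣ a p q with p Fin.≟ q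
... | yes _ = ℚP.≤-reflexive (cong ∣_∣ (ℚP.*-identityʳ a))
... | no  _ = subst (λ x → ∣ x ∣ ≤ ∣ a ∣) (sym (ℚP.*-zeroʳ a)) (ℚP.0≤∣p∣ a)

‖‖∞-lub : ∀ {n} {v : Fin n → ℚ} {b} → 0ℚ ≤ b → (∀ q → ∣ v q ∣ ≤ b) → ‖ v ‖∞ ≤ b
‖‖∞-lub {zero}  0≤b ∣v∣≤b = 0≤b
‖‖∞-lub {suc n} 0≤b ∣v∣≤b = ℚP.⊔-lub (∣v∣≤b Fin.zero) (‖‖∞-lub 0≤b (∣v∣≤b ∘ Fin.suc))

Σ-*𝟏 : ∀ n (a : Fin n → ℚ) q → Σ n (λ p → a p * 𝟏 p q) ≡ a q
Σ-*𝟏 n a q = begin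
  Σ n (λ p → a p * 𝟏 p q)   ≡⟨ Σ-vanishing-off n _ q (λ p p≢q → trans (cong (a p *_) (𝟏-≢ p≢q)) (ℚP.*-zeroʳ (a p))) ⟩
  a q * 𝟏 q q               ≡⟨ trans (cong (a q *_) (𝟏-refl q)) (ℚP.*-identityʳ (a q)) ⟩
  a q                       ∎
  where open ≡-Reasoning

-- One outcome of the sampler, with G = (g_π)_p and W = 2(u_f)_p − (g_π)_p: drawn with
-- conditional probability W/Z, it reports the value Z·G/W.
module ImportanceWeight {Z W G : ℚ} (∣G∣≤W : ∣ G ∣ ≤ W) (W≤Z : W ≤ Z) where

  estimate : ℚ
  estimate = (Z * G) /' W

  0≤W : 0ℚ ≤ W
  0≤W = ℚP.≤-trans (ℚP.0≤∣p∣ G) ∣G∣≤W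

  0≤Z : 0ℚ ≤ Z
  0≤Z = ℚP.≤-trans 0≤W W≤Z

  private
    module _ (W≡0 : W ≡ 0ℚ) where
      G≡0 : G ≡ 0ℚ
      G≡0 = ℚP.∣p∣≡0⇒p≡0 G (ℚP.≤-antisym (subst (∣ G ∣ ≤_) W≡0 ∣G∣≤W) (ℚP.0≤∣p∣ G))

      estimate≡0 : estimate ≡ 0ℚ
      estimate≡0 = cong ((Z * G) /'_) W≡0

    W≢0⇒Z≢0 : W ≢ 0ℚ → Z ≢ 0ℚ
    W≢0⇒Z≢0 W≢0 Z≡0 = ℚP.<-irrefl refl (subst (0ℚ <_) Z≡0 (ℚP.<-≤-trans (≤∧≢⇒< 0≤W (W≢0 ∘ sym)) W≤Z))

  unbiased : (W /' Z) * estimate ≡ G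
  unbiased with toSum (W ℚP.≟ 0ℚ)
  ... | inj₁ W≡0 = trans (cong ((W /' Z) *_) (estimate≡0 W≡0)) (trans (ℚP.*-zeroʳ (W /' Z)) (sym (G≡0 W≡0)))
  ... | inj₂ W≢0 = begin
    (W /' Z) * estimate                 ≡⟨ cong₂ _*_ (/'≡*1/' W Z) (/'≡*1/' (Z * G) W) ⟩
    W * Z⁻¹ * (Z * G * W⁻¹)             ≡⟨ solve 5 (λ W Z G Z⁻¹ W⁻¹ → W :* Z⁻¹ :* (Z :* G :* W⁻¹) := (W :* W⁻¹) :* (Z :* Z⁻¹) :* G) refl W Z G Z⁻¹ W⁻¹ ⟩
    (W * W⁻¹) * (Z * Z⁻¹) * G           ≡⟨ cong₂ (λ x y → x * y * G) (*-1/'-inverse W≢0) (*-1/'-inverse (W≢0⇒Z≢0 W≢0)) ⟩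
    1ℚ * 1ℚ * G                         ≡⟨ ℚP.*-identityˡ G ⟩
    G                                   ∎
    where
    open ≡-Reasoning
    Z⁻¹ = 1ℚ /' Z
    W⁻¹ = 1ℚ /' W

  bounded : ∣ estimate ∣ ≤ Z
  bounded with toSum (W ℚP.≟ 0ℚ)
  ... | inj₁ W≡0 = subst (λ e → ∣ e ∣ ≤ Z) (sym (estimate≡0 W≡0)) 0≤Z
  ... | inj₂ W≢0 = begin
    ∣ estimate ∣                 ≡⟨ cong ∣_∣ (/'≡*1/' (Z * G) W) ⟩
    ∣ Z * G * W⁻¹ ∣              ≡⟨ trans (ℚP.∣p*q∣≡∣p∣*∣q∣ (Z * G) W⁻¹) (cong₂ _*_ (ℚP.∣p*q∣≡∣p∣*∣q∣ Z G) (ℚP.0≤p⇒∣p∣≡p 0≤W⁻¹)) ⟩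
    ∣ Z ∣ * ∣ G ∣ * W⁻¹          ≡⟨ trans (cong (λ z → z * ∣ G ∣ * W⁻¹) (ℚP.0≤p⇒∣p∣≡p 0≤Z)) (ℚP.*-assoc Z ∣ G ∣ W⁻¹) ⟩
    Z * (∣ G ∣ * W⁻¹)            ≤⟨ ℚP.*-monoˡ-≤-nonNeg Z {{nonNegative 0≤Z}} (ℚP.*-monoʳ-≤-nonNeg W⁻¹ {{nonNegative 0≤W⁻¹}} ∣G∣≤W) ⟩
    Z * (W * W⁻¹)                ≡⟨ cong (Z *_) (*-1/'-inverse W≢0) ⟩
    Z * 1ℚ                       ≡⟨ ℚP.*-identityʳ Z ⟩
    Z                            ∎
    where
    open ℚP.≤-Reasoning
    W⁻¹ = 1ℚ /' W
    0≤W⁻¹ = 1/'-nonNeg 0≤W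

  second-moment : (W /' Z) * (estimate * estimate) ≤ Z * W
  second-moment = begin
    (W /' Z) * (estimate * estimate)   ≡⟨ trans (sym (ℚP.*-assoc (W /' Z) estimate estimate)) (cong (_* estimate) unbiased) ⟩
    G * estimate                       ≤⟨ p≤∣p∣ (G * estimate) ⟩
    ∣ G * estimate ∣                   ≡⟨ ℚP.∣p*q∣≡∣p∣*∣q∣ G estimate ⟩
    ∣ G ∣ * ∣ estimate ∣               ≤⟨ ℚP.*-monoʳ-≤-nonNeg ∣ estimate ∣ {{ℚP.∣-∣-nonNeg estimate}} ∣G∣≤W ⟩
    W * ∣ estimate ∣                   ≤⟨ ℚP.*-monoˡ-≤-nonNeg W {{nonNegative 0≤W}} bounded ⟩
    W * Z                              ≡⟨ ℚP.*-comm W Z ⟩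
    Z * W                              ∎
    where open ℚP.≤-Reasoning

-- Marginal gains along a permutation

module _ {n} (π : Permutation′ n) where

  position : Fin n → ℕ
  position q = toℕ (π ⟨$⟩ˡ q)

  position-injective : ∀ {x y} → position x ≡ position y → x ≡ y
  position-injective {x} {y} eq = begin
    x                          ≡⟨ inverseʳ π ⟨
    π ⟨$⟩ʳ (π ⟨$⟩ˡ x)          ≡⟨ cong (π ⟨$⟩ʳ_) (FinP.toℕ-injective eq) ⟩
    π ⟨$⟩ʳ (π ⟨$⟩ˡ y)          ≡⟨ inverseʳ π ⟩
    y                          ∎
    where open ≡-Reasoning

  ∈-prefix⁺ : ∀ {x k} → position x ℕ.< k → x ∈ prefix π k
  ∈-prefix⁺ {x} lt = lookup⇒[]= x _ (trans (lookup∘tabulate _ x) (Equivalence.to T-≡ (ℕP.<⇒<ᵇ lt)))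

  ∈-prefix⁻ : ∀ {x k} → x ∈ prefix π k → position x ℕ.< k
  ∈-prefix⁻ {x} {k} x∈ = ℕP.<ᵇ⇒< (position x) k
    (Equivalence.from T-≡ (trans (sym (lookup∘tabulate _ x)) ([]=⇒lookup x∈)))

  prefix-zero : prefix π 0 ≡ ⊥
  prefix-zero = Empty-unique λ (_ , x∈) → contradiction (∈-prefix⁻ {k = 0} x∈) λ ()

  prefix-all : prefix π n ≡ ⊤
  prefix-all = ⊆-antisym ⊆⊤ (λ {x} _ → ∈-prefix⁺ (FinP.toℕ<n (π ⟨$⟩ˡ x)))

  prefix-∪-⁅⁆ : ∀ q → prefix π (position q) ∪ ⁅ q ⁆ ≡ prefix π (suc (position q))
  prefix-∪-⁅⁆ q = ⊆-antisym ⊆ ⊇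
    where
    ⊆ : ∀ {x} → x ∈ prefix π (position q) ∪ ⁅ q ⁆ → x ∈ prefix π (suc (position q))
    ⊆ x∈ with x∈p∪q⁻ _ _ x∈
    ... | inj₁ x∈prefix = ∈-prefix⁺ (ℕP.m<n⇒m<1+n (∈-prefix⁻ x∈prefix))
    ... | inj₂ x∈⁅q⁆    = ∈-prefix⁺ (subst (λ y → position y ℕ.< suc (position q)) (sym (x∈⁅y⁆⇒x≡y q x∈⁅q⁆)) (ℕP.n<1+n _))
    ⊇ : ∀ {x} → x ∈ prefix π (suc (position q)) → x ∈ prefix π (position q) ∪ ⁅ q ⁆
    ⊇ {x} x∈ with ℕP.m<1+n⇒m<n∨m≡n (∈-prefix⁻ x∈)
    ... | inj₁ lt = x∈p∪q⁺ (inj₁ (∈-prefix⁺ lt))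
    ... | inj₂ eq = x∈p∪q⁺ (inj₂ (subst (_∈ ⁅ q ⁆) (sym (position-injective eq)) (x∈⁅x⁆ q)))

  prefix-∩-⁅⁆ : ∀ q → prefix π (position q) ∩ ⁅ q ⁆ ≡ ⊥
  prefix-∩-⁅⁆ q = Empty-unique λ (x , x∈) → let (x∈prefix , x∈⁅q⁆) = x∈p∩q⁻ _ _ x∈ in
    ℕP.<-irrefl (cong position (x∈⁅y⁆⇒x≡y q x∈⁅q⁆)) (∈-prefix⁻ x∈prefix)

Σ-marginal-gains : ∀ {n} (f : Subset n → ℚ) π → Σ n (g f π) ≡ f ⊤ - f ⊥
Σ-marginal-gains {n} f π = begin
  Σ n (g f π)                                ≡⟨ Σ-permute n (g f π) π ⟩
  Σ n (g f π ∘ (π ⟨$⟩ʳ_))                    ≡⟨ Σ-cong n (λ k → cong (λ j → F (suc (toℕ j)) - F (toℕ j)) (inverseˡ π)) ⟩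
  Σ n (λ k → F (suc (toℕ k)) - F (toℕ k))    ≡⟨ Σ-telescope n F ⟩
  F n - F 0                                  ≡⟨ cong₂ (λ A B → f A - f B) (prefix-all π) (prefix-zero π) ⟩
  f ⊤ - f ⊥                                  ∎
  where
  open ≡-Reasoning
  F : ℕ → ℚ
  F k = f (prefix π k)

submodular⇒diminishing-returns : ∀ {n} (f : Subset n → ℚ) → Submodular f →
                                 ∀ A B → f (A ∪ B) - f A ≤ f B - f (A ∩ B)
submodular⇒diminishing-returns f submodular A B = 0≤q-p⇒p≤q (subst (0ℚ ≤_)
  (solve 4 (λ a b a∪b a∩b → (a :+ b) :- (a∪b :+ a∩b) := (b :- a∩b) :- (a∪b :- a)) refl
         (f A) (f B) (f (A ∪ B)) (f (A ∩ B)))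
  (p≤q⇒0≤q-p (submodular A B)))

marginal-gain≤singleton : ∀ {n} (f : Subset n → ℚ) → Submodular f → f ⊥ ≡ 0ℚ →
                          ∀ π q → g f π q ≤ u f q
marginal-gain≤singleton f submodular f⊥≡0 π q = begin
  g f π q                        ≡⟨ cong (λ B → f B - f A) (prefix-∪-⁅⁆ π q) ⟨
  f (A ∪ ⁅ q ⁆) - f A            ≤⟨ submodular⇒diminishing-returns f submodular A ⁅ q ⁆ ⟩
  f ⁅ q ⁆ - f (A ∩ ⁅ q ⁆)        ≡⟨ cong (λ B → f ⁅ q ⁆ - f B) (prefix-∩-⁅⁆ π q) ⟩
  f ⁅ q ⁆ - f ⊥                  ≡⟨ cong (λ x → f ⁅ q ⁆ - x) f⊥≡0 ⟩
  f ⁅ q ⁆ - 0ℚ                   ≡⟨ ℚP.+-identityʳ (f ⁅ q ⁆) ⟩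
  u f q                          ∎
  where
  open ℚP.≤-Reasoning
  A = prefix π (position π q)

-- The sampling distribution

module SamplingProperties {n : ℕ} (m : ℕ) .{{_ : NonZero m}} (f : Subset n → ℚ) (submodular : Submodular f)
                                           (f⊥≡0 : f ⊥ ≡ 0ℚ) (u≥0 : ∀ p → 0ℚ ≤ u f p) (πs : Fin m → Permutation′ n) where

  open Sampling m f πs

  ∣g∣≤weight : ∀ i p → ∣ g f (πs i) p ∣ ≤ weight i p
  ∣g∣≤weight i p = ∣p∣≤2q-p (marginal-gain≤singleton f submodular f⊥≡0 (πs i) p) (u≥0 p)

  0≤weight : ∀ i p → 0ℚ ≤ weight i p
  0≤weight i p = ℚP.≤-trans (ℚP.0≤∣p∣ _) (∣g∣≤weight i p)

  Σ-weight : ∀ i → Σ n (weight i) ≡ Z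
  Σ-weight i = begin
    Σ n (λ p → 2ℚ * u f p - g f (πs i) p)           ≡⟨ Σ-distrib-minus n (λ p → 2ℚ * u f p) (g f (πs i)) ⟩
    Σ n (λ p → 2ℚ * u f p) - Σ n (g f (πs i))       ≡⟨ cong₂ _-_ (sym (*-distribˡ-Σ n 2ℚ (u f))) (Σ-marginal-gains f (πs i)) ⟩
    2ℚ * Σ n (u f) - (f ⊤ - f ⊥)                    ≡⟨ cong₂ (λ s b → 2ℚ * s - (f ⊤ - b)) (Σ-cong n (sym ∘ ℚP.0≤p⇒∣p∣≡p ∘ u≥0)) f⊥≡0 ⟩
    2ℚ * ‖ u f ‖₁ - (f ⊤ - 0ℚ)                      ≡⟨ cong (λ s → 2ℚ * ‖ u f ‖₁ - s) (ℚP.+-identityʳ (f ⊤)) ⟩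
    Z                                               ∎
    where open ≡-Reasoning

  weight≤Z : ∀ i p → weight i p ≤ Z
  weight≤Z i p = subst (weight i p ≤_) (Σ-weight i) (term≤Σ n (0≤weight i) p)

  0≤Z : Fin m → 0ℚ ≤ Z
  0≤Z i = subst (0ℚ ≤_) (Σ-weight i) (Σ-nonNeg n (0≤weight i))

  module Importance (i : Fin m) (p : Fin n) = ImportanceWeight (∣g∣≤weight i p) (weight≤Z i p)

  M : ℚ
  M = ℤ.+ m / 1

  0<M : 0ℚ < M
  0<M = ℚP.positive⁻¹ M {{ℚP.normalize-pos m 1}}

  prob≡ : ∀ i p → prob i p ≡ (weight i p /' Z) /' M
  prob≡ i p = cong (λ s → (weight i p /' s) /' M) (Σ-weight i)

  𝔼-*𝟏 : ∀ (X : Fin m → Fin n → ℚ) q → 𝔼 (λ i p → X i p * 𝟏 p q) ≡ Σ m (λ i → prob i q * X i q)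
  𝔼-*𝟏 X q = Σ-cong m λ i →
    trans (Σ-cong n (λ p → sym (ℚP.*-assoc (prob i p) (X i p) (𝟏 p q)))) (Σ-*𝟏 n (λ p → prob i p * X i p) q)

  prob-* : ∀ i q X → prob i q * X ≡ ((weight i q /' Z) * X) /' M
  prob-* i q X = trans (cong (_* X) (prob≡ i q)) (/'-*-comm (weight i q /' Z) X M)

  mean-weight : ∀ q → Σ m (λ i → weight i q) /' M ≡ 2ℚ * u f q - y q
  mean-weight q = begin
    Σ m (λ i → t - G i) /' M                ≡⟨ cong (_/' M) (Σ-distrib-minus m (λ _ → t) G) ⟩
    (Σ m (λ _ → t) - Σ m G) /' M           ≡⟨ cong (λ s → (s - Σ m G) /' M) (Σ-const m t) ⟩
    (M * t - Σ m G) /' M                   ≡⟨ /'≡*1/' _ M ⟩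
    (M * t - Σ m G) * M⁻¹                  ≡⟨ solve 4 (λ M t s M⁻¹ → (M :* t :- s) :* M⁻¹ := t :* (M :* M⁻¹) :- s :* M⁻¹) refl M t (Σ m G) M⁻¹ ⟩
    t * (M * M⁻¹) - Σ m G * M⁻¹            ≡⟨ cong₂ (λ x s → t * x - s) (*-1/'-inverse (ℚP.<⇒≢ 0<M ∘ sym)) (sym (/'≡*1/' (Σ m G) M)) ⟩
    t * 1ℚ - Σ m G /' M                    ≡⟨ cong (_- y q) (ℚP.*-identityʳ t) ⟩
    t - y q                                ∎
    where
    open ≡-Reasoning
    t = 2ℚ * u f q
    G : Fin m → ℚ
    G i = g f (πs i) q
    M⁻¹ = 1ℚ /' M

  unbiased : ∀ q → 𝔼 (λ i p → w i p q) ≡ y q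
  unbiased q = begin
    𝔼 (λ i p → w i p q)                   ≡⟨ 𝔼-*𝟏 c q ⟩
    Σ m (λ i → prob i q * c i q)          ≡⟨ Σ-cong m (λ i → trans (prob-* i q (c i q)) (cong (_/' M) (Importance.unbiased i q))) ⟩
    Σ m (λ i → g f (πs i) q /' M)         ≡⟨ Σ-/' m (λ i → g f (πs i) q) M ⟩
    y q                                   ∎
    where
    open ≡-Reasoning
    c = Importance.estimate

  bounded : ∀ i p → ‖ w i p ‖∞ ≤ Z
  bounded i p = ‖‖∞-lub (0≤Z i) λ q →
    ℚP.≤-trans (∣a*𝟏∣≤∣a∣ (Importance.estimate i p) p q) (Importance.bounded i p)

  second-moment : ∀ q → 𝔼 (λ i p → w i p q * w i p q) ≤ Z * (2ℚ * u f q - y q)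
  second-moment q = begin
    𝔼 (λ i p → w i p q * w i p q)                        ≡⟨ Σ-cong m (λ i → Σ-cong n (λ p → cong (prob i p *_) (square (c i p) p))) ⟩
    𝔼 (λ i p → (c i p * c i p) * 𝟏 p q)                  ≡⟨ 𝔼-*𝟏 (λ i p → c i p * c i p) q ⟩
    Σ m (λ i → prob i q * (c i q * c i q))               ≡⟨ Σ-cong m (λ i → prob-* i q _) ⟩
    Σ m (λ i → ((W i /' Z) * (c i q * c i q)) /' M)      ≤⟨ Σ-mono-≤ m (λ i → /'-monoˡ-≤ (ℚP.<⇒≤ 0<M) (Importance.second-moment i q)) ⟩
    Σ m (λ i → (Z * W i) /' M)                           ≡⟨ Σ-cong m (λ i → *-/'-assoc Z (W i) M) ⟩
    Σ m (λ i → Z * (W i /' M))                           ≡⟨ *-distribˡ-Σ m Z (λ i → W i /' M) ⟨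
    Z * Σ m (λ i → W i /' M)                             ≡⟨ cong (Z *_) (trans (Σ-/' m W M) (mean-weight q)) ⟩
    Z * (2ℚ * u f q - y q)                               ∎
    where
    open ℚP.≤-Reasoning
    c = Importance.estimate
    W : Fin m → ℚ
    W i = weight i q
    square : ∀ a p → (a * 𝟏 p q) * (a * 𝟏 p q) ≡ (a * a) * 𝟏 p q
    square a p = trans (solve 2 (λ a e → (a :* e) :* (a :* e) := (a :* a) :* (e :* e)) refl a (𝟏 p q))
                       (cong ((a * a) *_) (𝟏-idem p q))

claim6p8 : {n : ℕ} (m : ℕ) .{{_ : NonZero m}}
    (f : Subset n → ℚ) → Submodular f → f ⊥ ≡ 0ℚ → (∀ p → 0ℚ ≤ u f p) →
    (πs : Fin m → Permutation′ n) →
    let open Sampling m f πs in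
    (∀ q → 𝔼 (λ i p → w i p q) ≡ y q)
    × (∀ i p → 0ℚ < prob i p → ‖ w i p ‖∞ ≤ Z)
    × (∀ q → 𝔼 (λ i p → w i p q * w i p q) ≤ Z * (2ℚ * u f q - y q))
claim6p8 m f submodular f⊥≡0 u≥0 πs =
  -- the bound on ‖w‖∞ holds for every outcome, not only those of positive probability
  unbiased , (λ i p _ → bounded i p) , second-moment
  where open SamplingProperties m f submodular f⊥≡0 u≥0 πs
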